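{- If a hypergraph $\mathcal H=(V,\mathcal E)$ has the Helly property, then its edge intersection hypergraph $EI(\mathcal H)$ also has the Helly property.
   Context: A hypergraph $\mathcal H=(V,\mathcal E)$ consists of a finite vertex set $V$ and a set $\mathcal E$ of subsets of $V$ (hyperedges), without multiple hyperedges or loops. It has the Helly property if for every $\mathcal E'\subseteq\mathcal E$ such that any two members of $\mathcal E'$ have nonempty intersection, $\bigcap_{e\in\mathcal E'}e\neq\emptyset$. The edge intersection hypergraph is $EI(\mathcal H)=(V,\mathcal E^{EI})$ with $\mathcal E^{EI}=\{e_1\cap e_2 \mid e_1,e_2\in\mathcal E,\ e_1\neq e_2,\ |e_1\cap e_2|\ge 2\}$. -}

module Defs where

open import Data.Nat using (ℕ; _≤_)
open import Data.Fin using (Fin)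
open import Data.Fin.Subset using (Subset; _∈_; _∩_; ∣_∣; Nonempty)
open import Data.Product using (Σ; ∃; _×_; _,_)
open import Relation.Binary.PropositionalEquality using (_≡_; _≢_)

-- Hyperedges are subsets of V (Subset n = Vec Bool n); the edge set is a
-- (finite, since Subset n is finite) set of subsets, given as a predicate.
-- Being a set, there are no multiple hyperedges automatically.
record Hypergraph (n : ℕ) : Set₁ where
  field
    IsEdge   : Subset n → Set
    nonempty : ∀ e → IsEdge e → Nonempty e
open Hypergraph public

_⊆Fam_ : ∀ {n} → (Subset n → Set) → (Subset n → Set) → Set
F ⊆Fam E = ∀ e → F e → E e

HellyFam : ∀ {n} → (Subset n → Set) → Set₁
HellyFam {n} E =
  (F : Subset n → Set) → F ⊆Fam E →
  (∃ λ e → F e) →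
  (∀ e₁ e₂ → F e₁ → F e₂ → Nonempty (e₁ ∩ e₂)) →
  ∃ λ (v : Fin n) → ∀ e → F e → v ∈ e

Helly : ∀ {n} → Hypergraph n → Set₁
Helly H = HellyFam (IsEdge H)

EIEdge : ∀ {n} → Hypergraph n → Subset n → Set
EIEdge H s = Σ _ λ e₁ → Σ _ λ e₂ →
  IsEdge H e₁ × IsEdge H e₂ × e₁ ≢ e₂ × s ≡ e₁ ∩ e₂ × 2 ≤ ∣ s ∣

-- The edge intersection hypergraph EI(H) = (V, E^EI) has the same vertex
-- set; its Helly property is the Helly property of the family EIEdge H.
HellyEI : ∀ {n} → Hypergraph n → Set₁
HellyEI H = HellyFam (EIEdge H)

module Submission where

open import Defs
open import Data.Nat using (ℕ)
open import Data.Fin using (Fin)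
open import Data.Fin.Subset using (Subset; _∈_; _∩_; _⊆_; Nonempty)
open import Data.Fin.Subset.Properties using (p∩q⊆p; p∩q⊆q; x∈p∩q⁺; x∈p∩q⁻)
open import Data.Product using (∃; ∃₂; _×_; _,_; proj₁; map)
open import Function using (_∘_)
open import Relation.Binary.PropositionalEquality using (_≡_; refl)

-- Proof idea: let F be a pairwise intersecting family of sets of the form
-- e₁ ∩ e₂ with e₁, e₂ ∈ E. The edges of E containing some member of F are
-- again pairwise intersecting, so by the Helly property of E they share a
-- vertex v. Each s = e₁ ∩ e₂ in F has both e₁ and e₂ among those edges,
-- hence v ∈ s.

private
  variable
    n : ℕ

Meet₂ : (Subset n → Set) → Subset n → Set
Meet₂ E s = ∃₂ λ e₁ e₂ → E e₁ × E e₂ × s ≡ e₁ ∩ e₂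

Above : (Subset n → Set) → (Subset n → Set) → Subset n → Set
Above E F e = E e × ∃ λ s → F s × s ⊆ e

Nonempty-∩-mono : {s s′ e e′ : Subset n} →
                  s ⊆ e → s′ ⊆ e′ → Nonempty (s ∩ s′) → Nonempty (e ∩ e′)
Nonempty-∩-mono s⊆e s′⊆e′ (x , x∈s∩s′) =
  x , x∈p∩q⁺ (map s⊆e s′⊆e′ (x∈p∩q⁻ _ _ x∈s∩s′))

∈-Meet₂ : {E : Subset n → Set} {v : Fin n} {s : Subset n} →
          (∀ e → E e → s ⊆ e → v ∈ e) → Meet₂ E s → v ∈ s
∈-Meet₂ v∈ (e₁ , e₂ , E₁ , E₂ , refl) =
  x∈p∩q⁺ (v∈ e₁ E₁ (p∩q⊆p e₁ e₂) , v∈ e₂ E₂ (p∩q⊆q e₁ e₂))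

⊆Fam-trans : {F G H : Subset n → Set} → F ⊆Fam G → G ⊆Fam H → F ⊆Fam H
⊆Fam-trans F⊆G G⊆H s = G⊆H s ∘ F⊆G s

PairwiseIntersecting : (Subset n → Set) → Set
PairwiseIntersecting F = ∀ s s′ → F s → F s′ → Nonempty (s ∩ s′)

Above-pairwiseIntersecting : {E F : Subset n → Set} →
                             PairwiseIntersecting F → PairwiseIntersecting (Above E F)
Above-pairwiseIntersecting pairwise _ _ (_ , s , Fs , s⊆e) (_ , s′ , Fs′ , s′⊆e′) =
  Nonempty-∩-mono s⊆e s′⊆e′ (pairwise s s′ Fs Fs′)

Above-inhabited : {E F : Subset n → Set} → F ⊆Fam Meet₂ E → ∃ F → ∃ (Above E F)
Above-inhabited F⊆Meet₂ (s , Fs) with F⊆Meet₂ s Fs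
... | e₁ , e₂ , E₁ , _ , refl = e₁ , E₁ , s , Fs , p∩q⊆p e₁ e₂

HellyFam-Meet₂ : {E F : Subset n → Set} →
                 HellyFam E → F ⊆Fam Meet₂ E → HellyFam F
HellyFam-Meet₂ {E = E} helly F⊆Meet₂ G G⊆F inhabited pairwise
  with helly (Above E G) (λ _ → proj₁)
             (Above-inhabited (⊆Fam-trans G⊆F F⊆Meet₂) inhabited)
             (Above-pairwiseIntersecting pairwise)
... | v , v∈ =
  v , λ s Gs → ∈-Meet₂ (λ e Ee s⊆e → v∈ e (Ee , s , Gs , s⊆e))
                       (⊆Fam-trans G⊆F F⊆Meet₂ s Gs)

EIEdge⊆Meet₂ : (H : Hypergraph n) → EIEdge H ⊆Fam Meet₂ (IsEdge H)
EIEdge⊆Meet₂ H s (e₁ , e₂ , E₁ , E₂ , _ , s≡e₁∩e₂ , _) = e₁ , e₂ , E₁ , E₂ , s≡e₁∩e₂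

theorem3 : ∀ {n : ℕ} (H : Hypergraph n) → Helly H → HellyEI H
theorem3 H helly = HellyFam-Meet₂ helly (EIEdge⊆Meet₂ H)
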